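{- Let $n\ge 3$ and $m\ge 2$ be integers and consider the cycle-based self-similar graphs $G^{(i)}=G^{(i,m,n)}$ defined in the context. For $k\ge 0$ let $|V^{(k)}|$ denote the number of vertices of $G^{(k-1)}$, where $G^{(-1)}$ is a single vertex (so $|V^{(0)}|=1$, $|V^{(1)}|=n$). Then for every $i\ge 0$ the number of spanning trees of $G^{(i)}$ is $$\tau\big(G^{(i,m,n)}\big)=n^{\sum_{j=0}^{i}|V^{(j)}|}\; m^{\sum_{j=0}^{i}(i-j)|V^{(j)}|}.$$
   Context: The edge-path transformation replaces every edge of a graph by a path of length $m$ (inserting $m-1$ new internal vertices on each edge). The cycle-based model: $G^{(0)}=C_n$, and for $i\ge 0$, $G^{(i+1)}$ is obtained from $G^{(i)}$ by first applying the edge-path transformation, and then, for every vertex $v$ of $G^{(i)}$ (i.e. every vertex present before the subdivision), attaching a new copy of $C_n$ by identifying $v$ with one vertex of that copy. $\tau(G)$ denotes the number of spanning trees of $G$. -}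

module Defs where

open import Data.Nat using (ℕ; zero; suc; _+_; _*_; _∸_; _^_; _≡ᵇ_)
open import Data.Bool using (Bool; true; false; _∧_; _∨_; if_then_else_)
open import Data.List using (List; []; _∷_; _++_; map; concat; length; filter; upTo)
open import Data.Nat.ListAction using (sum)
open import Data.Bool.ListAction using (any; all)
open import Data.Product using (_×_; _,_)
open import Relation.Nullary.Decidable using (does)
open import Relation.Binary.PropositionalEquality using (_≡_)
open import Data.Bool using (T)
open import Data.Bool.Properties using (T?)

-- A finite (multi)graph: vertices are 0 .. nv-1, edges are a list of
-- unordered endpoint pairs (an edge (a , b) joins a and b).
record Graph : Set where
  constructor mkGraph
  field
    nv    : ℕ
    edges : List (ℕ × ℕ)
open Graph public

sublists : {A : Set} → List A → List (List A)
sublists []       = [] ∷ []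
sublists (x ∷ xs) = map (x ∷_) (sublists xs) ++ sublists xs

reach : List (ℕ × ℕ) → ℕ → ℕ → Bool
reach S zero    v = v ≡ᵇ 0
reach S (suc k) v =
  reach S k v ∨ any (λ { (a , b) → ((a ≡ᵇ v) ∧ reach S k b) ∨ ((b ≡ᵇ v) ∧ reach S k a) }) S

-- the spanning subgraph (0..nv-1, S) is connected
-- (a walk between two of nv vertices needs at most nv steps)
connectedᵇ : ℕ → List (ℕ × ℕ) → Bool
connectedᵇ nv S = all (reach S nv) (upTo nv)

isSpanningTreeᵇ : ℕ → List (ℕ × ℕ) → Bool
isSpanningTreeᵇ nv S = connectedᵇ nv S ∧ (length S ≡ᵇ (nv ∸ 1))

τ : Graph → ℕ
τ G = length (filter (λ S → T? (isSpanningTreeᵇ (nv G) S)) (sublists (edges G)))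

pathEdges : ℕ → ℕ → List ℕ → List (ℕ × ℕ)
pathEdges a b []        = (a , b) ∷ []
pathEdges a b (x ∷ xs)  = (a , x) ∷ pathEdges x b xs

cycleGraph : ℕ → Graph
cycleGraph n = mkGraph n (pathEdges 0 0 (map suc (upTo (n ∸ 1))))

-- edge-path transformation: replace every edge by a path of length m,
-- the e-th edge gets new internal vertices  base + e*(m-1) + j , j < m-1
subdivEdges : ℕ → ℕ → ℕ → List (ℕ × ℕ) → List (ℕ × ℕ)
subdivEdges m base e []              = []
subdivEdges m base e ((a , b) ∷ es)  =
  pathEdges a b (map (λ j → base + e * (m ∸ 1) + j) (upTo (m ∸ 1)))
  ++ subdivEdges m base (suc e) es

edgePath : ℕ → Graph → Graph
edgePath m G = mkGraph (nv G + length (edges G) * (m ∸ 1))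
                       (subdivEdges m (nv G) 0 (edges G))

-- attach a new copy of C_n at each of the first k vertices 0..k-1 of H
-- (the old vertices); the copy at v has new vertices base + v*(n-1) + j, j < n-1
attachCycles : ℕ → ℕ → Graph → Graph
attachCycles n k H =
  mkGraph (nv H + k * (n ∸ 1))
          (edges H ++ concat (map (λ v → pathEdges v v
                 (map (λ j → nv H + v * (n ∸ 1) + j) (upTo (n ∸ 1)))) (upTo k)))

step : ℕ → ℕ → Graph → Graph
step m n G = attachCycles n (nv G) (edgePath m G)

cycleSelfSimilar : (i m n : ℕ) → Graph
cycleSelfSimilar zero    m n = cycleGraph n
cycleSelfSimilar (suc i) m n = step m n (cycleSelfSimilar i m n)

V : ℕ → ℕ → ℕ → ℕ
V m n zero    = 1
V m n (suc k) = nv (cycleSelfSimilar k m n)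

Σ≤ : ℕ → (ℕ → ℕ) → ℕ
Σ≤ i f = sum (map f (upTo (suc i)))

-- G^(i) is a cactus: a graph assembled from cycles, each new cycle glued at one
-- vertex onto what was built before.  Subdividing every edge into m edges keeps
-- it a cactus and multiplies every cycle length by m; attaching copies of C_n
-- adds cycles of length n.  A spanning tree of a cactus keeps all but one edge
-- of every cycle, and every such choice is a spanning tree, so τ is the product
-- of the cycle lengths.  The cycles of G^(i) are one copy of C_n for each vertex
-- of G^(j-1), 0 ≤ j ≤ i, subdivided i - j times, i.e. of length n m^(i-j).

module Submission where

open import Defs
open import Data.Bool using (Bool; true; false; _∧_; T)
open import Data.Bool.Properties using (T-∧; T-∨; T-≡; ⇔→≡)
open import Data.Empty using (⊥-elim)
open import Data.List using (List; []; _∷_; _++_; map; concatMap; length; filterᵇ; upTo; applyUpTo)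
open import Data.List.Membership.Propositional using (_∈_; _∉_; find; lose)
open import Data.List.Membership.Propositional.Properties
  using (∈-++⁻; ∈-++⁺ˡ; ∈-++⁺ʳ; ∈-map⁻; ∈-concat⁻′; ∈-upTo⁻)
open import Data.List.Properties
  using (length-++; length-map; length-upTo; ++-assoc; ++-identityʳ; filter-++; map-++; map-id; map-∘;
         map-cong-local; map-upTo; upTo-∷ʳ; map-concatMap; concatMap-cong; concatMap-map; concatMap-++)
open import Data.List.Relation.Binary.Equality.Propositional using (≋⇒≡)
open import Data.List.Relation.Binary.Permutation.Propositional
  using (_↭_; ↭-sym; ↭-refl; ↭-reflexive; prep; ↭⇒↭ₛ; module PermutationReasoning)
open import Data.List.Relation.Binary.Permutation.Propositional.Properties
  using (All-resp-↭; ∈-resp-↭; ↭-length; ++⁺; ++⁺ˡ; ++⁺ʳ; shifts)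
import Data.List.Relation.Binary.Permutation.Setoid.Properties as ↭ₛ
open import Data.List.Relation.Binary.Pointwise using (Pointwise; []; _∷_)
open import Data.List.Relation.Binary.Sublist.Propositional as Sublist
  using ([]; _∷_; _∷ʳ_) renaming (_⊆_ to _⊑_)
open import Data.List.Relation.Binary.Sublist.Propositional.Properties using (to-≋)
open import Data.List.Relation.Binary.Subset.Propositional using (_⊆_)
open import Data.List.Relation.Unary.All as All using (All; []; _∷_)
open import Data.List.Relation.Unary.All.Properties as All using (all⁺; all⁻)
open import Data.List.Relation.Unary.Any using (here; there)
open import Data.List.Relation.Unary.Any.Properties using (any⁺; any⁻)
open import Data.List.Relation.Unary.Unique.Propositional using (Unique; []; _∷_)
open import Data.List.Relation.Unary.Unique.Propositional.Properties using (Unique[x∷xs]⇒x∉xs; upTo⁺)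
open import Data.Nat using (ℕ; zero; suc; _+_; _*_; _^_; _∸_; _≤_; _<_; _≤′_; ≤′-refl; ≤′-step; s≤s; z≤n; _≡ᵇ_)
open import Data.Nat.Combinatorics using (_C_; nCk+nC[k+1]≡[n+1]C[k+1]; nCk≡nC[n∸k]; nC1≡n)
open import Data.Nat.ListAction using (sum)
open import Data.Nat.ListAction.Properties using (sum-++)
open import Data.Nat.Properties
open import Algebra.Properties.CommutativeSemigroup +-commutativeSemigroup using (interchange)
open import Data.Nat.Solver using (module +-*-Solver)
open import Data.Product using (∃; Σ-syntax; ∃-syntax; _×_; _,_; proj₁; proj₂)
open import Data.Sum using (_⊎_; inj₁; inj₂)
open import Data.Unit using (⊤)
open import Function using (Equivalence; _∘_; mk⇔)
open import Relation.Binary.PropositionalEquality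
open import Relation.Nullary using (¬_; yes; no)
open import Relation.Nullary.Decidable using (T?)

open Equivalence using (to; from)
open +-*-Solver using (solve; _:*_; _:=_)

private variable A B : Set

T-ext : ∀ {a b} → (T a → T b) → (T b → T a) → a ≡ b
T-ext f g = ⇔→≡ (mk⇔ (to T-≡ ∘ f ∘ from T-≡) (to T-≡ ∘ g ∘ from T-≡))

Unique-resp-↭ : ∀ {xs ys : List A} → xs ↭ ys → Unique xs → Unique ys
Unique-resp-↭ p = ↭ₛ.Unique-resp-↭ (setoid _) (↭⇒↭ₛ p)

Unique-++⁻ : ∀ (xs : List A) {ys} → Unique (xs ++ ys) →
             Unique xs × Unique ys × (∀ {u} → u ∈ xs → u ∉ ys)
Unique-++⁻ []       U = [] , U , λ ()
Unique-++⁻ (x ∷ xs) (x≢ ∷ U) with Unique-++⁻ xs U | All.++⁻ xs x≢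
... | Uxs , Uys , disjoint | x≢xs , x≢ys = (x≢xs ∷ Uxs) , Uys , x∉
  where
  x∉ : ∀ {u} → u ∈ x ∷ xs → u ∉ _
  x∉ (here refl) u∈ys = All.lookup x≢ys u∈ys refl
  x∉ (there u∈xs)     = disjoint u∈xs

+-tight : ∀ {a a′ b b′} → a ≤ a′ → b ≤ b′ → a′ + b′ ≡ a + b → a′ ≡ a × b′ ≡ b
+-tight {a} {a′} {b} {b′} a≤a′ b≤b′ eq = a′≡a , +-cancelˡ-≡ a b′ b (trans (cong (_+ b′) (sym a′≡a)) eq)
  where
  a′≡a : a′ ≡ a
  a′≡a = ≤-antisym (+-cancelʳ-≤ b′ a′ a (≤-trans (≤-reflexive eq) (+-monoʳ-≤ a b≤b′))) a≤a′

+-*-suc : ∀ a s d → a + suc s * d ≡ a + s * d + d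
+-*-suc a s d = trans (cong (a +_) (+-comm d (s * d))) (sym (+-assoc a (s * d) d))

sublists⁻ : ∀ (E : List A) {t} → t ∈ sublists E → t ⊑ E
sublists⁻ []      (here refl) = []
sublists⁻ (e ∷ E) m with ∈-++⁻ (map (e ∷_) (sublists E)) m
... | inj₂ m′ = e ∷ʳ sublists⁻ E m′
... | inj₁ m′ with ∈-map⁻ (e ∷_) m′
... | t , m″ , refl = refl ∷ sublists⁻ E m″

count : (A → Bool) → List A → ℕ
count p xs = length (filterᵇ p xs)

count-++ : ∀ (p : A → Bool) xs ys → count p (xs ++ ys) ≡ count p xs + count p ys
count-++ p xs ys = trans (cong length (filter-++ (T? ∘ p) xs ys)) (length-++ (filterᵇ p xs))

count-map : ∀ (p : B → Bool) (f : A → B) xs → count p (map f xs) ≡ count (p ∘ f) xs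
count-map p f []       = refl
count-map p f (x ∷ xs) with p (f x)
... | true  = cong suc (count-map p f xs)
... | false = count-map p f xs

count-cong : ∀ {p q : A → Bool} {xs} → All (λ x → p x ≡ q x) xs → count p xs ≡ count q xs
count-cong [] = refl
count-cong {p = p} {q = q} {xs = x ∷ xs} (px≡qx ∷ eqs) with p x | q x | px≡qx
... | true  | true  | refl = cong suc (count-cong eqs)
... | false | false | refl = count-cong eqs

count-false : ∀ (xs : List A) → count (λ _ → false) xs ≡ 0
count-false []       = refl
count-false (x ∷ xs) = count-false xs

hasLength : ℕ → List A → Bool
hasLength k t = length t ≡ᵇ k

count-sublists-hasLength : ∀ (E : List A) k → count (hasLength k) (sublists E) ≡ length E C k
count-sublists-hasLength []      zero    = refl
count-sublists-hasLength []      (suc k) = refl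
count-sublists-hasLength (e ∷ E) k = begin
  count (hasLength k) (map (e ∷_) (sublists E) ++ sublists E)
    ≡⟨ count-++ (hasLength k) (map (e ∷_) (sublists E)) (sublists E) ⟩
  count (hasLength k) (map (e ∷_) (sublists E)) + count (hasLength k) (sublists E)
    ≡⟨ cong₂ _+_ (count-map (hasLength k) (e ∷_) (sublists E)) (count-sublists-hasLength E k) ⟩
  count (hasLength k ∘ (e ∷_)) (sublists E) + length E C k
    ≡⟨ pascal k ⟩
  suc (length E) C k ∎
  where
  open ≡-Reasoning
  pascal : ∀ k → count (hasLength k ∘ (e ∷_)) (sublists E) + length E C k ≡ suc (length E) C k
  pascal zero    = cong (_+ length E C 0) (count-false (sublists E))
  pascal (suc k) = trans (cong (_+ length E C suc k) (count-sublists-hasLength E k))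
                         (nCk+nC[k+1]≡[n+1]C[k+1] (length E) k)

count-sublists-dropOne : ∀ (E : List A) k → length E ≡ suc k → count (hasLength k) (sublists E) ≡ suc k
count-sublists-dropOne E k |E|≡ = begin
  count (hasLength k) (sublists E) ≡⟨ count-sublists-hasLength E k ⟩
  length E C k                     ≡⟨ cong (_C k) |E|≡ ⟩
  suc k C k                        ≡⟨ nCk≡nC[n∸k] (n≤1+n k) ⟩
  suc k C (suc k ∸ k)              ≡⟨ cong (suc k C_) (m+n∸n≡m 1 k) ⟩
  suc k C 1                        ≡⟨ nC1≡n (suc k) ⟩
  suc k                            ∎
  where open ≡-Reasoning

sublists-++ : ∀ {A : Set} (X Y : List A) →
              sublists (X ++ Y) ≡ concatMap (λ s → map (s ++_) (sublists Y)) (sublists X)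
sublists-++ []      Y = sym (trans (++-identityʳ _) (map-id (sublists Y)))
sublists-++ {A} (x ∷ X) Y = begin
  map (x ∷_) (sublists (X ++ Y)) ++ sublists (X ++ Y)
    ≡⟨ cong (λ S → map (x ∷_) S ++ S) (sublists-++ X Y) ⟩
  map (x ∷_) (C (sublists X)) ++ C (sublists X)
    ≡⟨ cong (_++ C (sublists X)) (map-concatMap (x ∷_) extend (sublists X)) ⟩
  concatMap (map (x ∷_) ∘ extend) (sublists X) ++ C (sublists X)
    ≡⟨ cong (_++ C (sublists X)) (concatMap-cong (λ s → sym (map-∘ (sublists Y))) (sublists X)) ⟩
  concatMap (extend ∘ (x ∷_)) (sublists X) ++ C (sublists X)
    ≡⟨ cong (_++ C (sublists X)) (sym (concatMap-map extend (x ∷_) (sublists X))) ⟩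
  C (map (x ∷_) (sublists X)) ++ C (sublists X)
    ≡⟨ sym (concatMap-++ extend (map (x ∷_) (sublists X)) (sublists X)) ⟩
  C (map (x ∷_) (sublists X) ++ sublists X) ∎
  where
  open ≡-Reasoning
  extend : List A → List (List A)
  extend s = map (s ++_) (sublists Y)
  C : List (List A) → List (List A)
  C = concatMap extend

Edge : Set
Edge = ℕ × ℕ

Adjacent : List Edge → ℕ → ℕ → Set
Adjacent S u w = (u , w) ∈ S ⊎ (w , u) ∈ S

EndpointsIn : List Edge → (ℕ → Set) → Set
EndpointsIn S P = ∀ {a b} → (a , b) ∈ S → P a × P b

-- A record rather than T (reach S k v), so that S, k and v can be inferred.
record Reachable (S : List Edge) (k v : ℕ) : Set where
  constructor reached
  field reachedᵇ : T (reach S k v)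

Closed : List Edge → (ℕ → Set) → Set
Closed S X = ∀ {a b} → (a , b) ∈ S → (X a → X b) × (X b → X a)

adjacent-++⁻ : ∀ S {t u w} → Adjacent (S ++ t) u w → Adjacent S u w ⊎ Adjacent t u w
adjacent-++⁻ S (inj₁ m) with ∈-++⁻ S m
... | inj₁ m′ = inj₁ (inj₁ m′)
... | inj₂ m′ = inj₂ (inj₁ m′)
adjacent-++⁻ S (inj₂ m) with ∈-++⁻ S m
... | inj₁ m′ = inj₁ (inj₂ m′)
... | inj₂ m′ = inj₂ (inj₂ m′)

adjacent-endpoints : ∀ {S P u w} → EndpointsIn S P → Adjacent S u w → P u × P w
adjacent-endpoints h (inj₁ m) = h m
adjacent-endpoints h (inj₂ m) = proj₂ (h m) , proj₁ (h m)

reach-zero⁻ : ∀ S {v} → Reachable S 0 v → v ≡ 0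
reach-zero⁻ S {v} (reached r) = ≡ᵇ⇒≡ v 0 r

reach-suc : ∀ S {k v} → Reachable S k v → Reachable S (suc k) v
reach-suc S (reached r) = reached (from T-∨ (inj₁ r))

reach-adjacent : ∀ S {k v w} → Adjacent S v w → Reachable S k w → Reachable S (suc k) v
reach-adjacent S {k} {v} (inj₁ m) (reached r) = reached
  (from T-∨ (inj₂ (any⁺ _ (lose m (from T-∨ (inj₁ (from T-∧ (≡⇒≡ᵇ v v refl , r))))))))
reach-adjacent S {k} {v} {w} (inj₂ m) (reached r) = reached
  (from T-∨ (inj₂ (any⁺ _ (lose m
    (from (T-∨ {(w ≡ᵇ v) ∧ reach S k v}) (inj₂ (from T-∧ (≡⇒≡ᵇ v v refl , r))))))))

reach-suc⁻ : ∀ S {k v} → Reachable S (suc k) v →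
             Reachable S k v ⊎ ∃[ w ] Adjacent S v w × Reachable S k w
reach-suc⁻ S {k} {v} (reached r) with to T-∨ r
... | inj₁ r′ = inj₁ (reached r′)
... | inj₂ r′ with find (any⁻ _ S r′)
... | (a , b) , m , t with to (T-∨ {(a ≡ᵇ v) ∧ reach S k b}) t
... | inj₁ t′ with to T-∧ t′
... | a≡v , rb with ≡ᵇ⇒≡ a v a≡v
... | refl = inj₂ (b , inj₁ m , reached rb)
reach-suc⁻ S {k} {v} _ | inj₂ _ | (a , b) , m , _ | inj₂ t′ with to T-∧ t′
... | b≡v , ra with ≡ᵇ⇒≡ b v b≡v
... | refl = inj₂ (a , inj₂ m , reached ra)

reach-mono : ∀ S {k k′ v} → k ≤ k′ → Reachable S k v → Reachable S k′ v
reach-mono S k≤k′ = go (≤⇒≤′ k≤k′)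
  where
  go : ∀ {k k′ v} → k ≤′ k′ → Reachable S k v → Reachable S k′ v
  go ≤′-refl r = r
  go (≤′-step k≤k′) r = reach-suc S (go k≤k′ r)

reach-⊆ : ∀ {S S′} → S ⊆ S′ → ∀ k {v} → Reachable S k v → Reachable S′ k v
reach-⊆ S⊆S′ zero (reached r) = reached r
reach-⊆ {S} {S′} S⊆S′ (suc k) r with reach-suc⁻ S r
... | inj₁ r′ = reach-suc S′ (reach-⊆ S⊆S′ k r′)
... | inj₂ (w , inj₁ m , r′) = reach-adjacent S′ (inj₁ (S⊆S′ m)) (reach-⊆ S⊆S′ k r′)
... | inj₂ (w , inj₂ m , r′) = reach-adjacent S′ (inj₂ (S⊆S′ m)) (reach-⊆ S⊆S′ k r′)

closed-unreachable : ∀ S {X} → ¬ X 0 → Closed S X → ∀ k {u} → X u → ¬ Reachable S k u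
closed-unreachable S {X} ¬X0 closed zero Xu r = ¬X0 (subst X (reach-zero⁻ S r) Xu)
closed-unreachable S ¬X0 closed (suc k) Xu r with reach-suc⁻ S r
... | inj₁ r′ = closed-unreachable S ¬X0 closed k Xu r′
... | inj₂ (w , inj₁ m , r′) = closed-unreachable S ¬X0 closed k (proj₁ (closed m) Xu) r′
... | inj₂ (w , inj₂ m , r′) = closed-unreachable S ¬X0 closed k (proj₂ (closed m) Xu) r′

PathVertex : ℕ → List ℕ → ℕ → ℕ → Set
PathVertex a xs b u = u ≡ a ⊎ u ∈ xs ⊎ u ≡ b

pathEdges-endpoints : ∀ a b xs → EndpointsIn (pathEdges a b xs) (PathVertex a xs b)
pathEdges-endpoints a b []       (here refl) = inj₁ refl , inj₂ (inj₂ refl)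
pathEdges-endpoints a b (x ∷ xs) (here refl) = inj₁ refl , inj₂ (inj₁ (here refl))
pathEdges-endpoints a b (x ∷ xs) (there m)   =
  shift (proj₁ (pathEdges-endpoints x b xs m)) , shift (proj₂ (pathEdges-endpoints x b xs m))
  where
  shift : ∀ {u} → PathVertex x xs b u → PathVertex a (x ∷ xs) b u
  shift (inj₁ refl)        = inj₂ (inj₁ (here refl))
  shift (inj₂ (inj₁ u∈xs)) = inj₂ (inj₁ (there u∈xs))
  shift (inj₂ (inj₂ u≡b))  = inj₂ (inj₂ u≡b)

length-pathEdges : ∀ a b xs → length (pathEdges a b xs) ≡ suc (length xs)
length-pathEdges a b []       = refl
length-pathEdges a b (x ∷ xs) = cong suc (length-pathEdges x b xs)

⊑⇒⊆ : ∀ {A : Set} {xs ys : List A} → xs ⊑ ys → xs ⊆ ys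
⊑⇒⊆ s = Sublist.lookup s

record Island (t : List Edge) (P : ℕ → Set) : Set₁ where
  field
    member  : ℕ → Set
    within  : ∀ {u} → member u → P u
    closed  : Closed t member

off-path : ∀ {x y ys b u} → All (x ≢_) (y ∷ ys) → b ∉ x ∷ y ∷ ys → PathVertex y ys b u → u ≢ x
off-path x∉ b∉ (inj₁ refl)        refl = All.lookup x∉ (here refl) refl
off-path x∉ b∉ (inj₂ (inj₁ u∈ys)) refl = All.lookup x∉ (there u∈ys) refl
off-path x∉ b∉ (inj₂ (inj₂ refl)) refl = b∉ (here refl)

path-start-island : ∀ x b xs {t} → t ⊑ pathEdges x b xs → Unique (x ∷ xs) → b ∉ x ∷ xs →
                    length t ≤ length xs → Σ[ I ∈ Island t (_∈ x ∷ xs) ] Island.member I x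
path-start-island x b [] (_ ∷ʳ []) _ _ _ =
  record { member = _≡ x ; within = λ { refl → here refl } ; closed = λ () } , refl
path-start-island x b (y ∷ ys) {t} (_ ∷ʳ s) (x∉ ∷ _) b∉ _ =
  record { member = _≡ x ; within = λ { refl → here refl } ; closed = closed } , refl
  where
  closed : Closed t (_≡ x)
  closed m = let u-on , u′-on = pathEdges-endpoints y b ys (⊑⇒⊆ s m) in
      (λ u≡x → ⊥-elim (off-path x∉ b∉ u-on u≡x))
    , (λ u′≡x → ⊥-elim (off-path x∉ b∉ u′-on u′≡x))
path-start-island x b (y ∷ ys) (refl ∷ s) (x∉ ∷ U) b∉ (s≤s le)
  with path-start-island y b ys s U (b∉ ∘ there) le
... | I , Iy = record { member = member ; within = within ; closed = closed } , inj₁ refl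
  where
  open Island I renaming (member to member′; within to within′; closed to closed′)
  member : ℕ → Set
  member u = u ≡ x ⊎ member′ u
  within : ∀ {u} → member u → u ∈ x ∷ y ∷ ys
  within (inj₁ refl) = here refl
  within (inj₂ p)    = there (within′ p)
  closed : Closed ((x , y) ∷ _) member
  closed (here refl)          = (λ _ → inj₂ Iy) , (λ _ → inj₁ refl)
  closed {u} {u′} (there m) with pathEdges-endpoints y b ys (⊑⇒⊆ s m)
  ... | u-on , u′-on = forth , back
    where
    forth : member u → member u′
    forth (inj₁ u≡x) = ⊥-elim (off-path x∉ b∉ u-on u≡x)
    forth (inj₂ p)   = inj₂ (proj₁ (closed′ m) p)
    back : member u′ → member u
    back (inj₁ u′≡x) = ⊥-elim (off-path x∉ b∉ u′-on u′≡x)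
    back (inj₂ p)    = inj₂ (proj₂ (closed′ m) p)

path-inner-island : ∀ a b xs {t} → t ⊑ pathEdges a b xs → a ∉ xs → Unique xs → b ∉ xs →
                    length t < length xs → Σ[ I ∈ Island t (_∈ xs) ] ∃ (Island.member I)
path-inner-island a b (x ∷ xs) (refl ∷ s) a∉ (x∉ ∷ U) b∉ (s≤s lt)
  with path-inner-island x b xs s (Unique[x∷xs]⇒x∉xs (x∉ ∷ U)) U (b∉ ∘ there) lt
... | I , u , Iu = record { member = member ; within = there ∘ within ; closed = closed′ } , u , Iu
  where
  open Island I
  closed′ : Closed ((a , x) ∷ _) member
  closed′ (here refl) = (λ p → ⊥-elim (a∉ (there (within p))))
                      , (λ p → ⊥-elim (Unique[x∷xs]⇒x∉xs (x∉ ∷ U) (within p)))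
  closed′ (there m)   = closed m
path-inner-island a b (x ∷ xs) (_ ∷ʳ s) a∉ U b∉ (s≤s le) with path-start-island x b xs s U b∉ le
... | I , Ix = I , x , Ix

reach-along-path : ∀ {S} a b xs k → pathEdges a b xs ⊆ S → Reachable S k b →
                   ∀ {y} → y ∈ a ∷ xs → Reachable S (suc (length xs) + k) y
reach-along-path {S} a b [] k path⊆S rb (here refl) = reach-adjacent S (inj₁ (path⊆S (here refl))) rb
reach-along-path {S} a b (x ∷ xs) k path⊆S rb (here refl) =
  reach-adjacent S (inj₁ (path⊆S (here refl))) (reach-along-path x b xs k (path⊆S ∘ there) rb (here refl))
reach-along-path {S} a b (x ∷ xs) k path⊆S rb (there y∈) =
  reach-suc S (reach-along-path x b xs k (path⊆S ∘ there) rb y∈)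

reach-interior : ∀ {S} a b xs {t} k → t ⊑ pathEdges a b xs → length t ≡ length xs → t ⊆ S →
                 Reachable S k a → Reachable S k b → ∀ {x} → x ∈ xs → Reachable S (length xs + k) x
reach-interior {S} a b (x ∷ xs) k (refl ∷ s) |t|≡ t⊆S ra rb x∈ = go x∈
  where
  rx : Reachable S (suc k) x
  rx = reach-adjacent S (inj₂ (t⊆S (here refl))) ra
  go : ∀ {y} → y ∈ x ∷ xs → Reachable S (suc (length xs + k)) y
  go (here refl) = reach-mono S (s≤s (m≤n+m k (length xs))) rx
  go {y} (there y∈) = subst (λ j → Reachable S j y) (+-suc (length xs) k)
    (reach-interior x b xs (suc k) s (suc-injective |t|≡) (t⊆S ∘ there) rx (reach-suc S rb) y∈)
reach-interior {S} a b (x ∷ xs) k (_ ∷ʳ s) |t|≡ t⊆S ra rb x∈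
  with ≋⇒≡ (to-≋ (trans |t|≡ (sym (length-pathEdges x b xs))) s)
... | refl = reach-along-path x b xs k t⊆S rb x∈

pathEdges-++ : ∀ a z b xs ys → pathEdges a z xs ++ pathEdges z b ys ≡ pathEdges a b (xs ++ z ∷ ys)
pathEdges-++ a z b []       ys = refl
pathEdges-++ a z b (x ∷ xs) ys = cong ((a , x) ∷_) (pathEdges-++ x z b xs ys)

-- t hangs at v: S avoids the private vertices xs of t, so any walk from 0
-- into xs passes through v first.
module Pendant {S t : List Edge} {xs : List ℕ} {v : ℕ}
  (S-avoids : EndpointsIn S (_∉ xs))
  (t-within : EndpointsIn t (PathVertex v xs v))
  (0∉xs : 0 ∉ xs) (v∉xs : v ∉ xs) where

  reach-outside : ∀ k {u} → u ∉ xs → Reachable (S ++ t) k u → Reachable S k u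
  reach-inside : ∀ k {x} → x ∈ xs → Reachable (S ++ t) k x → Reachable S k v

  reach-via : ∀ k {w} → PathVertex v xs v w → Reachable (S ++ t) k w → Reachable S k v
  reach-via k (inj₁ refl)        r = reach-outside k v∉xs r
  reach-via k (inj₂ (inj₁ w∈xs)) r = reach-inside k w∈xs r
  reach-via k (inj₂ (inj₂ refl)) r = reach-outside k v∉xs r

  reach-outside zero u∉xs (reached r) = reached r
  reach-outside (suc k) u∉xs r with reach-suc⁻ (S ++ t) r
  ... | inj₁ r′ = reach-suc S (reach-outside k u∉xs r′)
  ... | inj₂ (w , adj , r′) with adjacent-++⁻ S adj
  ... | inj₁ adjS = reach-adjacent S adjS (reach-outside k (proj₂ (adjacent-endpoints S-avoids adjS)) r′)
  ... | inj₂ adjt with adjacent-endpoints t-within adjt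
  ... | inj₁ refl , w-within        = reach-suc S (reach-via k w-within r′)
  ... | inj₂ (inj₁ u∈xs) , _        = ⊥-elim (u∉xs u∈xs)
  ... | inj₂ (inj₂ refl) , w-within = reach-suc S (reach-via k w-within r′)

  reach-inside zero x∈xs r = ⊥-elim (0∉xs (subst (_∈ xs) (reach-zero⁻ (S ++ t) r) x∈xs))
  reach-inside (suc k) x∈xs r with reach-suc⁻ (S ++ t) r
  ... | inj₁ r′ = reach-suc S (reach-inside k x∈xs r′)
  ... | inj₂ (w , adj , r′) with adjacent-++⁻ S adj
  ... | inj₁ adjS = ⊥-elim (proj₁ (adjacent-endpoints S-avoids adjS) x∈xs)
  ... | inj₂ adjt = reach-suc S (reach-via k (proj₂ (adjacent-endpoints t-within adjt)) r′)

-- A cactus is a list of cycles, newest first.  The cycle (v , xs) is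
-- v - xs - v, glued at its anchor v onto the older cycles; the empty cactus is
-- the single vertex 0.
Cycle : Set
Cycle = ℕ × List ℕ

cycleEdges : Cycle → List Edge
cycleEdges (v , xs) = pathEdges v v xs

Cactus : Set
Cactus = List Cycle

vertices : Cactus → List ℕ
vertices []             = 0 ∷ []
vertices ((v , xs) ∷ r) = vertices r ++ xs

cactusEdges : Cactus → List Edge
cactusEdges []      = []
cactusEdges (c ∷ r) = cactusEdges r ++ cycleEdges c

Anchored : Cactus → Set
Anchored []             = ⊤
Anchored ((v , xs) ∷ r) = v ∈ vertices r × Anchored r

innerCount : Cactus → ℕ
innerCount []             = 0
innerCount ((v , xs) ∷ r) = innerCount r + length xs

cycleLengthProduct : Cactus → ℕ
cycleLengthProduct []             = 1
cycleLengthProduct ((v , xs) ∷ r) = suc (length xs) * cycleLengthProduct r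

0∈vertices : ∀ r → 0 ∈ vertices r
0∈vertices []      = here refl
0∈vertices (c ∷ r) = ∈-++⁺ˡ (0∈vertices r)

length-vertices : ∀ r → length (vertices r) ≡ suc (innerCount r)
length-vertices []             = refl
length-vertices ((v , xs) ∷ r) = trans (length-++ (vertices r)) (cong (_+ length xs) (length-vertices r))

extensions : Cycle → List (List Edge) → List (List (List Edge))
extensions c ts = map (_∷ ts) (sublists (cycleEdges c))

choices : Cactus → List (List (List Edge))
choices []      = [] ∷ []
choices (c ∷ r) = concatMap (extensions c) (choices r)

⋃ : List (List Edge) → List Edge
⋃ []       = []
⋃ (t ∷ ts) = ⋃ ts ++ t

IsChoice : Cactus → List (List Edge) → Set
IsChoice = Pointwise (λ c t → t ⊑ cycleEdges c)

choices⁻ : ∀ r {ts} → ts ∈ choices r → IsChoice r ts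
choices⁻ []      (here refl) = []
choices⁻ (c ∷ r) m with ∈-concat⁻′ (map (extensions c) (choices r)) m
... | _ , m₁ , m₂ with ∈-map⁻ (extensions c) m₂
... | ts , ts∈ , refl with ∈-map⁻ (_∷ ts) m₁
... | t , t∈ , refl = sublists⁻ (cycleEdges c) t∈ ∷ choices⁻ r ts∈

map-⋃-choices : ∀ r → map ⋃ (choices r) ≡ sublists (cactusEdges r)
map-⋃-choices []      = refl
map-⋃-choices (c ∷ r) = begin
  map ⋃ (concatMap (extensions c) (choices r))
    ≡⟨ map-concatMap ⋃ (extensions c) (choices r) ⟩
  concatMap (map ⋃ ∘ extensions c) (choices r)
    ≡⟨ concatMap-cong (λ ts → sym (map-∘ SC)) (choices r) ⟩
  concatMap (extend ∘ ⋃) (choices r)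
    ≡⟨ sym (concatMap-map extend ⋃ (choices r)) ⟩
  concatMap extend (map ⋃ (choices r))
    ≡⟨ cong (concatMap extend) (map-⋃-choices r) ⟩
  concatMap extend (sublists (cactusEdges r))
    ≡⟨ sym (sublists-++ (cactusEdges r) (cycleEdges c)) ⟩
  sublists (cactusEdges r ++ cycleEdges c) ∎
  where
  open ≡-Reasoning
  SC : List (List Edge)
  SC = sublists (cycleEdges c)
  extend : List Edge → List (List Edge)
  extend s = map (s ++_) SC

missesOneEachᵇ : Cactus → List (List Edge) → Bool
missesOneEachᵇ []             []       = true
missesOneEachᵇ ((v , xs) ∷ r) (t ∷ ts) = missesOneEachᵇ r ts ∧ hasLength (length xs) t
missesOneEachᵇ _              _        = false

count-choices : ∀ r → count (missesOneEachᵇ r) (choices r) ≡ cycleLengthProduct r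
count-choices []               = refl
count-choices (c@(v , xs) ∷ r) =
  trans (count-extensions (choices r)) (cong (suc (length xs) *_) (count-choices r))
  where
  SC : List (List Edge)
  SC = sublists (cycleEdges c)
  count-SC : count (hasLength (length xs)) SC ≡ suc (length xs)
  count-SC = count-sublists-dropOne (cycleEdges c) (length xs) (length-pathEdges v v xs)
  count-extensions : ∀ L → count (missesOneEachᵇ (c ∷ r)) (concatMap (extensions c) L)
                           ≡ suc (length xs) * count (missesOneEachᵇ r) L
  count-extensions []       = sym (*-zeroʳ (suc (length xs)))
  count-extensions (ts ∷ L) = begin
    count (missesOneEachᵇ (c ∷ r)) (extensions c ts ++ concatMap (extensions c) L)
      ≡⟨ count-++ (missesOneEachᵇ (c ∷ r)) (extensions c ts) (concatMap (extensions c) L) ⟩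
    count (missesOneEachᵇ (c ∷ r)) (extensions c ts) + count (missesOneEachᵇ (c ∷ r)) (concatMap (extensions c) L)
      ≡⟨ cong₂ _+_ (count-map (missesOneEachᵇ (c ∷ r)) (_∷ ts) SC) (count-extensions L) ⟩
    count (λ t → missesOneEachᵇ r ts ∧ hasLength (length xs) t) SC + suc (length xs) * count (missesOneEachᵇ r) L
      ≡⟨ add-extension ⟩
    suc (length xs) * count (missesOneEachᵇ r) (ts ∷ L) ∎
    where
    open ≡-Reasoning
    add-extension : count (λ t → missesOneEachᵇ r ts ∧ hasLength (length xs) t) SC
                      + suc (length xs) * count (missesOneEachᵇ r) L
                    ≡ suc (length xs) * count (missesOneEachᵇ r) (ts ∷ L)
    add-extension with missesOneEachᵇ r ts
    ... | true  = trans (cong (_+ _) count-SC) (sym (*-suc (suc (length xs)) _))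
    ... | false = cong (_+ _) (count-false SC)

⋃-endpoints : ∀ r {ts} → Anchored r → IsChoice r ts → EndpointsIn (⋃ ts) (_∈ vertices r)
⋃-endpoints ((v , xs) ∷ r) {_ ∷ ts} (v∈ , anchored) (t⊑ ∷ choice) m with ∈-++⁻ (⋃ ts) m
... | inj₁ m′ = let a∈ , b∈ = ⋃-endpoints r anchored choice m′ in ∈-++⁺ˡ a∈ , ∈-++⁺ˡ b∈
... | inj₂ m′ = let a∈ , b∈ = pathEdges-endpoints v v xs (⊑⇒⊆ t⊑ m′) in onCycle a∈ , onCycle b∈
  where
  onCycle : ∀ {u} → PathVertex v xs v u → u ∈ vertices r ++ xs
  onCycle (inj₁ refl)        = ∈-++⁺ˡ v∈
  onCycle (inj₂ (inj₁ u∈xs)) = ∈-++⁺ʳ (vertices r) u∈xs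
  onCycle (inj₂ (inj₂ refl)) = ∈-++⁺ˡ v∈

EnoughEdges : Cactus → List (List Edge) → Set
EnoughEdges = Pointwise (λ c t → length (proj₂ c) ≤ length t)

reachesAll⇒enoughEdges : ∀ r {ts} K → Anchored r → Unique (vertices r) → IsChoice r ts →
                         All (Reachable (⋃ ts) K) (vertices r) → EnoughEdges r ts
reachesAll⇒enoughEdges []             K _ _ [] _ = []
reachesAll⇒enoughEdges ((v , xs) ∷ r) {t ∷ ts} K (v∈ , anchored) U (t⊑ ∷ choice) reachesAll
  with Unique-++⁻ (vertices r) U
... | Ur , Uxs , disjoint = enough ∷ reachesAll⇒enoughEdges r K anchored Ur choice reachesAllʳ
  where
  ts-avoids : EndpointsIn (⋃ ts) (_∉ xs)
  ts-avoids m = let a∈ , b∈ = ⋃-endpoints r anchored choice m in disjoint a∈ , disjoint b∈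
  open Pendant ts-avoids (λ m → pathEdges-endpoints v v xs (⊑⇒⊆ t⊑ m))
               (disjoint (0∈vertices r)) (disjoint v∈)
  reachesAllʳ : All (Reachable (⋃ ts) K) (vertices r)
  reachesAllʳ = All.tabulate λ u∈ → reach-outside K (disjoint u∈) (All.lookup reachesAll (∈-++⁺ˡ u∈))
  -- Otherwise t lacks two edges of the cycle, cutting an arc of xs off from 0.
  enough : length xs ≤ length t
  enough with length xs ≤? length t
  ... | yes le = le
  ... | no ¬le with path-inner-island v v xs t⊑ (disjoint v∈) Uxs (disjoint v∈) (≰⇒> ¬le)
  ... | I , u , Iu = ⊥-elim (closed-unreachable (⋃ ts ++ t) (disjoint (0∈vertices r) ∘ within) closed′ K Iu
                              (All.lookup reachesAll (∈-++⁺ʳ (vertices r) (within Iu))))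
    where
    open Island I
    closed′ : Closed (⋃ ts ++ t) member
    closed′ m with ∈-++⁻ (⋃ ts) m
    ... | inj₁ m′ = (λ p → ⊥-elim (proj₁ (ts-avoids m′) (within p)))
                  , (λ p → ⊥-elim (proj₂ (ts-avoids m′) (within p)))
    ... | inj₂ m′ = closed m′

enoughEdges⇒innerCount≤ : ∀ {r ts} → EnoughEdges r ts → innerCount r ≤ length (⋃ ts)
enoughEdges⇒innerCount≤ []                        = z≤n
enoughEdges⇒innerCount≤ {_ ∷ _} {t ∷ ts} (le ∷ ps) =
  subst (_ ≤_) (sym (length-++ (⋃ ts))) (+-mono-≤ (enoughEdges⇒innerCount≤ ps) le)

enoughEdges⇒missesOneEach : ∀ r {ts} → EnoughEdges r ts → length (⋃ ts) ≡ innerCount r →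
                            T (missesOneEachᵇ r ts)
enoughEdges⇒missesOneEach []             []                  _  = _
enoughEdges⇒missesOneEach ((v , xs) ∷ r) {t ∷ ts} (le ∷ ps) eq =
  from T-∧ (enoughEdges⇒missesOneEach r ps (proj₁ tight) , ≡⇒≡ᵇ _ _ (proj₂ tight))
  where
  tight : length (⋃ ts) ≡ innerCount r × length t ≡ length xs
  tight = +-tight (enoughEdges⇒innerCount≤ ps) le (trans (sym (length-++ (⋃ ts))) eq)

missesOneEach⇒length : ∀ r {ts} → T (missesOneEachᵇ r ts) → length (⋃ ts) ≡ innerCount r
missesOneEach⇒length []             {[]}     _ = refl
missesOneEach⇒length ((v , xs) ∷ r) {t ∷ ts} m with to T-∧ m
... | m′ , |t|≡ = trans (length-++ (⋃ ts)) (cong₂ _+_ (missesOneEach⇒length r m′) (≡ᵇ⇒≡ _ _ |t|≡))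

missesOneEach⇒reachesAll : ∀ r {ts} → Anchored r → IsChoice r ts → T (missesOneEachᵇ r ts) →
                           All (Reachable (⋃ ts) (innerCount r)) (vertices r)
missesOneEach⇒reachesAll [] _ [] _ = reached _ ∷ []
missesOneEach⇒reachesAll ((v , xs) ∷ r) {t ∷ ts} (v∈ , anchored) (t⊑ ∷ choice) m with to T-∧ m
... | m′ , |t|≡ = All.++⁺ (All.map (reach-mono _ (m≤m+n _ _)) reachesAllʳ) (All.tabulate reach-xs)
  where
  reachesAllʳ : All (Reachable (⋃ ts ++ t) (innerCount r)) (vertices r)
  reachesAllʳ = All.map (reach-⊆ ∈-++⁺ˡ (innerCount r)) (missesOneEach⇒reachesAll r anchored choice m′)
  rv : Reachable (⋃ ts ++ t) (innerCount r) v
  rv = All.lookup reachesAllʳ v∈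
  reach-xs : ∀ {x} → x ∈ xs → Reachable (⋃ ts ++ t) (innerCount r + length xs) x
  reach-xs {x} x∈ = subst (λ k → Reachable (⋃ ts ++ t) k x) (+-comm (length xs) (innerCount r))
    (reach-interior v v xs (innerCount r) t⊑ (≡ᵇ⇒≡ _ _ |t|≡) (∈-++⁺ʳ (⋃ ts)) rv rv x∈)

-- Connectivity leaves every cycle at most one edge short, and the edge count
-- N - 1 = innerCount r then forces exactly one missing edge per cycle.
isSpanningTree≡missesOneEach : ∀ r {N ts} → Anchored r → vertices r ↭ upTo N → IsChoice r ts →
                               isSpanningTreeᵇ N (⋃ ts) ≡ missesOneEachᵇ r ts
isSpanningTree≡missesOneEach r {N} {ts} anchored perm choice = T-ext to′ from′
  where
  N≡ : N ≡ suc (innerCount r)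
  N≡ = trans (sym (length-upTo N)) (trans (sym (↭-length perm)) (length-vertices r))
  N∸1≡ : N ∸ 1 ≡ innerCount r
  N∸1≡ = cong (_∸ 1) N≡
  to′ : T (isSpanningTreeᵇ N (⋃ ts)) → T (missesOneEachᵇ r ts)
  to′ h with to T-∧ h
  ... | connected , |⋃ts|≡ = enoughEdges⇒missesOneEach r
    (reachesAll⇒enoughEdges r N anchored (Unique-resp-↭ (↭-sym perm) (upTo⁺ N)) choice
      (All-resp-↭ (↭-sym perm) (All.map reached (all⁺ _ (upTo N) connected))))
    (trans (≡ᵇ⇒≡ _ _ |⋃ts|≡) N∸1≡)
  from′ : T (missesOneEachᵇ r ts) → T (isSpanningTreeᵇ N (⋃ ts))
  from′ m = from T-∧
    ( all⁻ _ (All.map Reachable.reachedᵇ (All-resp-↭ perm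
        (All.map (reach-mono _ (subst (innerCount r ≤_) (sym N≡) (n≤1+n _)))
                 (missesOneEach⇒reachesAll r anchored choice m))))
    , ≡⇒≡ᵇ _ _ (trans (missesOneEach⇒length r m) (sym N∸1≡)))

record IsCactusOf (G : Graph) (r : Cactus) : Set where
  field
    anchored  : Anchored r
    vertices↭ : vertices r ↭ upTo (nv G)
    edges≡    : cactusEdges r ≡ edges G

τ-cactus : ∀ {G r} → IsCactusOf G r → τ G ≡ cycleLengthProduct r
τ-cactus {G} {r} isCactus = begin
  count (isSpanningTreeᵇ (nv G)) (sublists (edges G))
    ≡⟨ cong (count (isSpanningTreeᵇ (nv G)) ∘ sublists) (sym edges≡) ⟩
  count (isSpanningTreeᵇ (nv G)) (sublists (cactusEdges r))
    ≡⟨ cong (count (isSpanningTreeᵇ (nv G))) (sym (map-⋃-choices r)) ⟩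
  count (isSpanningTreeᵇ (nv G)) (map ⋃ (choices r))
    ≡⟨ count-map (isSpanningTreeᵇ (nv G)) ⋃ (choices r) ⟩
  count (isSpanningTreeᵇ (nv G) ∘ ⋃) (choices r)
    ≡⟨ count-cong (All.tabulate (isSpanningTree≡missesOneEach r anchored vertices↭ ∘ choices⁻ r)) ⟩
  count (missesOneEachᵇ r) (choices r)
    ≡⟨ count-choices r ⟩
  cycleLengthProduct r ∎
  where
  open ≡-Reasoning
  open IsCactusOf isCactus

interval : ℕ → ℕ → List ℕ
interval a zero    = []
interval a (suc k) = a ∷ interval (suc a) k

applyUpTo≡interval : ∀ {f} a k → (∀ j → f j ≡ a + j) → applyUpTo f k ≡ interval a k
applyUpTo≡interval a zero    _  = refl
applyUpTo≡interval a (suc k) f≡ = cong₂ _∷_ (trans (f≡ 0) (+-identityʳ a))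
  (applyUpTo≡interval (suc a) k (λ j → trans (f≡ (suc j)) (+-suc a j)))

upTo≡interval : ∀ k → upTo k ≡ interval 0 k
upTo≡interval k = applyUpTo≡interval 0 k (λ _ → refl)

map-upTo≡interval : ∀ a k → map (a +_) (upTo k) ≡ interval a k
map-upTo≡interval a k = trans (map-upTo (a +_) k) (applyUpTo≡interval a k (λ _ → refl))

length-interval : ∀ a k → length (interval a k) ≡ k
length-interval a zero    = refl
length-interval a (suc k) = cong suc (length-interval (suc a) k)

interval-++ : ∀ a k l → interval a k ++ interval (a + k) l ≡ interval a (k + l)
interval-++ a zero    l = cong (λ b → interval b l) (+-identityʳ a)
interval-++ a (suc k) l = cong (a ∷_) (trans (cong (λ b → interval (suc a) k ++ interval b l) (+-suc a k))
                                             (interval-++ (suc a) k l))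

concatMap-intervals : ∀ a d s k →
                      concatMap (λ v → interval (a + v * d) d) (interval s k) ≡ interval (a + s * d) (k * d)
concatMap-intervals a d s zero    = refl
concatMap-intervals a d s (suc k) = begin
  interval (a + s * d) d ++ concatMap (λ v → interval (a + v * d) d) (interval (suc s) k)
    ≡⟨ cong (interval (a + s * d) d ++_) (concatMap-intervals a d (suc s) k) ⟩
  interval (a + s * d) d ++ interval (a + suc s * d) (k * d)
    ≡⟨ cong (λ b → interval (a + s * d) d ++ interval b (k * d)) (+-*-suc a s d) ⟩
  interval (a + s * d) d ++ interval (a + s * d + d) (k * d)
    ≡⟨ interval-++ (a + s * d) d (k * d) ⟩
  interval (a + s * d) (d + k * d) ∎
  where open ≡-Reasoning

graft : List Cycle → Cactus → Cactus
graft []       r = r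
graft (c ∷ cs) r = graft cs (c ∷ r)

cactusEdges-graft : ∀ cs r → cactusEdges (graft cs r) ≡ cactusEdges r ++ concatMap cycleEdges cs
cactusEdges-graft []       r = sym (++-identityʳ (cactusEdges r))
cactusEdges-graft (c ∷ cs) r = trans (cactusEdges-graft cs (c ∷ r)) (++-assoc (cactusEdges r) (cycleEdges c) _)

vertices-graft : ∀ cs r → vertices (graft cs r) ≡ vertices r ++ concatMap proj₂ cs
vertices-graft []              r = sym (++-identityʳ (vertices r))
vertices-graft ((v , xs) ∷ cs) r = trans (vertices-graft cs ((v , xs) ∷ r)) (++-assoc (vertices r) xs _)

anchored-graft : ∀ cs r → All ((_∈ vertices r) ∘ proj₁) cs → Anchored r → Anchored (graft cs r)
anchored-graft []              r _            anchored = anchored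
anchored-graft ((v , xs) ∷ cs) r (v∈ ∷ anchors) anchored =
  anchored-graft cs ((v , xs) ∷ r) (All.map ∈-++⁺ˡ anchors) (v∈ , anchored)

cycleLengthProduct-graft : ∀ cs r → cycleLengthProduct (graft cs r) ≡ cycleLengthProduct cs * cycleLengthProduct r
cycleLengthProduct-graft []              r = sym (+-identityʳ (cycleLengthProduct r))
cycleLengthProduct-graft ((v , xs) ∷ cs) r = begin
  cycleLengthProduct (graft cs ((v , xs) ∷ r))
    ≡⟨ cycleLengthProduct-graft cs ((v , xs) ∷ r) ⟩
  cycleLengthProduct cs * (suc (length xs) * cycleLengthProduct r)
    ≡⟨ sym (*-assoc (cycleLengthProduct cs) _ _) ⟩
  cycleLengthProduct cs * suc (length xs) * cycleLengthProduct r
    ≡⟨ cong (_* cycleLengthProduct r) (*-comm (cycleLengthProduct cs) _) ⟩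
  suc (length xs) * cycleLengthProduct cs * cycleLengthProduct r ∎
  where open ≡-Reasoning

length-graft : ∀ cs r → length (graft cs r) ≡ length cs + length r
length-graft []       r = refl
length-graft (c ∷ cs) r = trans (length-graft cs (c ∷ r)) (+-suc (length cs) (length r))

sum-map-+ : ∀ (f g : A → ℕ) xs → sum (map (λ x → f x + g x) xs) ≡ sum (map f xs) + sum (map g xs)
sum-map-+ f g []       = refl
sum-map-+ f g (x ∷ xs) = trans (cong (f x + g x +_) (sum-map-+ f g xs))
                               (interchange (f x) (g x) (sum (map f xs)) (sum (map g xs)))

Σ≤-suc : ∀ i f → Σ≤ (suc i) f ≡ Σ≤ i f + f (suc i)
Σ≤-suc i f = begin
  sum (map f (upTo (suc (suc i))))               ≡⟨ cong (sum ∘ map f) (sym (upTo-∷ʳ (suc i))) ⟩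
  sum (map f (upTo (suc i) ++ suc i ∷ []))       ≡⟨ cong sum (map-++ f (upTo (suc i)) (suc i ∷ [])) ⟩
  sum (map f (upTo (suc i)) ++ f (suc i) ∷ [])   ≡⟨ sum-++ (map f (upTo (suc i))) (f (suc i) ∷ []) ⟩
  Σ≤ i f + (f (suc i) + 0)                       ≡⟨ cong (Σ≤ i f +_) (+-identityʳ (f (suc i))) ⟩
  Σ≤ i f + f (suc i)                             ∎
  where open ≡-Reasoning

Σ≤-weighted-suc : ∀ i f →
                  Σ≤ (suc i) (λ j → (suc i ∸ j) * f j) ≡ Σ≤ i (λ j → (i ∸ j) * f j) + Σ≤ i f
Σ≤-weighted-suc i f = begin
  Σ≤ (suc i) (λ j → (suc i ∸ j) * f j)
    ≡⟨ Σ≤-suc i (λ j → (suc i ∸ j) * f j) ⟩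
  Σ≤ i (λ j → (suc i ∸ j) * f j) + (i ∸ i) * f (suc i)
    ≡⟨ cong (λ k → Σ≤ i (λ j → (suc i ∸ j) * f j) + k * f (suc i)) (n∸n≡0 i) ⟩
  Σ≤ i (λ j → (suc i ∸ j) * f j) + 0
    ≡⟨ +-identityʳ _ ⟩
  Σ≤ i (λ j → (suc i ∸ j) * f j)
    ≡⟨ cong sum (map-cong-local {f = λ j → (suc i ∸ j) * f j} {g = λ j → f j + (i ∸ j) * f j}
                   (All.tabulate (λ {j} j∈ → cong (_* f j) (+-∸-assoc 1 (≤-pred (∈-upTo⁻ j∈)))))) ⟩
  sum (map (λ j → f j + (i ∸ j) * f j) (upTo (suc i)))
    ≡⟨ sum-map-+ f (λ j → (i ∸ j) * f j) (upTo (suc i)) ⟩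
  Σ≤ i f + Σ≤ i (λ j → (i ∸ j) * f j)
    ≡⟨ +-comm (Σ≤ i f) _ ⟩
  Σ≤ i (λ j → (i ∸ j) * f j) + Σ≤ i f ∎
  where open ≡-Reasoning

-- Parametrised by m′ = m - 1 and n′ = n - 1, so that the m ∸ 1 and n ∸ 1 of
-- Defs reduce.
module Construction (m′ n′ : ℕ) where

  m n : ℕ
  m = suc m′
  n = suc n′

  -- subdivEdges gives the e-th edge of the list the new vertices b + e m′ + j,
  -- j < m′; along a cycle whose edges are numbered from e these blocks
  -- alternate with the old vertices.
  block : ℕ → ℕ → List ℕ
  block b e = interval (b + e * m′) m′

  subdividedInner : ℕ → ℕ → List ℕ → List ℕ
  subdividedInner b e []       = block b e
  subdividedInner b e (x ∷ xs) = block b e ++ x ∷ subdividedInner b (suc e) xs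

  subdivide : ℕ → Cactus → Cactus
  subdivide b []             = []
  subdivide b ((v , xs) ∷ r) = (v , subdividedInner b (length (cactusEdges r)) xs) ∷ subdivide b r

  subdivEdges-++ : ∀ b e E F → subdivEdges m b e (E ++ F) ≡ subdivEdges m b e E ++ subdivEdges m b (length E + e) F
  subdivEdges-++ b e []            F = refl
  subdivEdges-++ b e ((p , q) ∷ E) F = begin
    P ++ subdivEdges m b (suc e) (E ++ F)
      ≡⟨ cong (P ++_) (subdivEdges-++ b (suc e) E F) ⟩
    P ++ (subdivEdges m b (suc e) E ++ subdivEdges m b (length E + suc e) F)
      ≡⟨ cong (λ k → P ++ (subdivEdges m b (suc e) E ++ subdivEdges m b k F)) (+-suc (length E) e) ⟩
    P ++ (subdivEdges m b (suc e) E ++ subdivEdges m b (suc (length E + e)) F)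
      ≡⟨ sym (++-assoc P _ _) ⟩
    (P ++ subdivEdges m b (suc e) E) ++ subdivEdges m b (suc (length E + e)) F ∎
    where
    open ≡-Reasoning
    P : List Edge
    P = pathEdges p q (map (λ j → b + e * m′ + j) (upTo m′))

  subdivEdges-pathEdges : ∀ b e a z xs → subdivEdges m b e (pathEdges a z xs) ≡ pathEdges a z (subdividedInner b e xs)
  subdivEdges-pathEdges b e a z []       =
    trans (++-identityʳ _) (cong (pathEdges a z) (map-upTo≡interval (b + e * m′) m′))
  subdivEdges-pathEdges b e a z (x ∷ xs) =
    trans (cong₂ _++_ (cong (pathEdges a x) (map-upTo≡interval (b + e * m′) m′))
                      (subdivEdges-pathEdges b (suc e) x z xs))
          (pathEdges-++ a x z (block b e) (subdividedInner b (suc e) xs))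

  subdivEdges-cactusEdges : ∀ b r → subdivEdges m b 0 (cactusEdges r) ≡ cactusEdges (subdivide b r)
  subdivEdges-cactusEdges b []             = refl
  subdivEdges-cactusEdges b ((v , xs) ∷ r) =
    trans (subdivEdges-++ b 0 (cactusEdges r) (pathEdges v v xs))
          (cong₂ _++_ (subdivEdges-cactusEdges b r)
                      (trans (cong (λ e → subdivEdges m b e (pathEdges v v xs)) (+-identityʳ _))
                             (subdivEdges-pathEdges b (length (cactusEdges r)) v v xs)))

  subdividedInner-↭ : ∀ b e xs → subdividedInner b e xs ↭ xs ++ interval (b + e * m′) (suc (length xs) * m′)
  subdividedInner-↭ b e []       = ↭-reflexive (cong (interval (b + e * m′)) (sym (*-identityˡ m′)))
  subdividedInner-↭ b e (x ∷ xs) = begin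
    block b e ++ x ∷ subdividedInner b (suc e) xs
      ↭⟨ ++⁺ˡ (block b e) (prep x (subdividedInner-↭ b (suc e) xs)) ⟩
    block b e ++ (x ∷ xs) ++ interval (b + suc e * m′) (suc (length xs) * m′)
      ↭⟨ shifts (block b e) (x ∷ xs) ⟩
    (x ∷ xs) ++ block b e ++ interval (b + suc e * m′) (suc (length xs) * m′)
      ≡⟨ cong (λ c → (x ∷ xs) ++ block b e ++ interval c (suc (length xs) * m′)) (+-*-suc b e m′) ⟩
    (x ∷ xs) ++ block b e ++ interval (b + e * m′ + m′) (suc (length xs) * m′)
      ≡⟨ cong ((x ∷ xs) ++_) (interval-++ (b + e * m′) m′ (suc (length xs) * m′)) ⟩
    (x ∷ xs) ++ interval (b + e * m′) (suc (suc (length xs)) * m′) ∎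
    where open PermutationReasoning

  length-subdividedInner : ∀ b e xs → length (subdividedInner b e xs) ≡ length xs + suc (length xs) * m′
  length-subdividedInner b e xs = begin
    length (subdividedInner b e xs)
      ≡⟨ ↭-length (subdividedInner-↭ b e xs) ⟩
    length (xs ++ interval (b + e * m′) (suc (length xs) * m′))
      ≡⟨ length-++ xs ⟩
    length xs + length (interval (b + e * m′) (suc (length xs) * m′))
      ≡⟨ cong (length xs +_) (length-interval _ _) ⟩
    length xs + suc (length xs) * m′ ∎
    where open ≡-Reasoning

  vertices-subdivide : ∀ b r → vertices (subdivide b r) ↭ vertices r ++ interval b (length (cactusEdges r) * m′)
  vertices-subdivide b []             = ↭-refl
  vertices-subdivide b ((v , xs) ∷ r) = begin
    vertices (subdivide b r) ++ subdividedInner b E xs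
      ↭⟨ ++⁺ (vertices-subdivide b r) (subdividedInner-↭ b E xs) ⟩
    (vertices r ++ interval b (E * m′)) ++ (xs ++ interval (b + E * m′) (suc (length xs) * m′))
      ≡⟨ ++-assoc (vertices r) _ _ ⟩
    vertices r ++ interval b (E * m′) ++ xs ++ interval (b + E * m′) (suc (length xs) * m′)
      ↭⟨ ++⁺ˡ (vertices r) (shifts (interval b (E * m′)) xs) ⟩
    vertices r ++ xs ++ interval b (E * m′) ++ interval (b + E * m′) (suc (length xs) * m′)
      ≡⟨ sym (++-assoc (vertices r) xs _) ⟩
    (vertices r ++ xs) ++ interval b (E * m′) ++ interval (b + E * m′) (suc (length xs) * m′)
      ≡⟨ cong ((vertices r ++ xs) ++_) (interval-++ b (E * m′) (suc (length xs) * m′)) ⟩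
    (vertices r ++ xs) ++ interval b (E * m′ + suc (length xs) * m′)
      ≡⟨ cong (λ k → (vertices r ++ xs) ++ interval b k) (sym (*-distribʳ-+ m′ E (suc (length xs)))) ⟩
    (vertices r ++ xs) ++ interval b ((E + suc (length xs)) * m′)
      ≡⟨ cong (λ k → (vertices r ++ xs) ++ interval b (k * m′)) (sym |E′|≡) ⟩
    (vertices r ++ xs) ++ interval b (length (cactusEdges r ++ pathEdges v v xs) * m′) ∎
    where
    open PermutationReasoning
    E : ℕ
    E = length (cactusEdges r)
    |E′|≡ : length (cactusEdges r ++ pathEdges v v xs) ≡ E + suc (length xs)
    |E′|≡ = trans (length-++ (cactusEdges r)) (cong (E +_) (length-pathEdges v v xs))

  anchored-subdivide : ∀ b r → Anchored r → Anchored (subdivide b r)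
  anchored-subdivide b []             _                = _
  anchored-subdivide b ((v , xs) ∷ r) (v∈ , anchored) =
    ∈-resp-↭ (↭-sym (vertices-subdivide b r)) (∈-++⁺ˡ v∈) , anchored-subdivide b r anchored

  length-subdivide : ∀ b r → length (subdivide b r) ≡ length r
  length-subdivide b []      = refl
  length-subdivide b (c ∷ r) = cong suc (length-subdivide b r)

  cycleLengthProduct-subdivide : ∀ b r → cycleLengthProduct (subdivide b r) ≡ m ^ length r * cycleLengthProduct r
  cycleLengthProduct-subdivide b []             = refl
  cycleLengthProduct-subdivide b ((v , xs) ∷ r) = begin
    suc (length (subdividedInner b E xs)) * cycleLengthProduct (subdivide b r)
      ≡⟨ cong₂ _*_ |cycle|≡ (cycleLengthProduct-subdivide b r) ⟩
    suc (length xs) * m * (m ^ length r * cycleLengthProduct r)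
      ≡⟨ solve 4 (λ ℓ m M P → ℓ :* m :* (M :* P) := m :* M :* (ℓ :* P)) refl
                 (suc (length xs)) m (m ^ length r) (cycleLengthProduct r) ⟩
    m * m ^ length r * (suc (length xs) * cycleLengthProduct r) ∎
    where
    open ≡-Reasoning
    E : ℕ
    E = length (cactusEdges r)
    |cycle|≡ : suc (length (subdividedInner b E xs)) ≡ suc (length xs) * m
    |cycle|≡ = trans (cong suc (length-subdividedInner b E xs)) (sym (*-suc (suc (length xs)) m′))

  attachedCycle : ℕ → ℕ → Cycle
  attachedCycle N′ v = v , map (λ j → N′ + v * n′ + j) (upTo n′)

  newCycles : Graph → List Cycle
  newCycles G = map (attachedCycle (nv (edgePath m G))) (upTo (nv G))

  stepCactus : Graph → Cactus → Cactus
  stepCactus G r = graft (newCycles G) (subdivide (nv G) r)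

  vertices-newCycles : ∀ G → concatMap proj₂ (newCycles G) ≡ interval (nv (edgePath m G)) (nv G * n′)
  vertices-newCycles G = begin
    concatMap proj₂ (map (attachedCycle N′) (upTo (nv G)))
      ≡⟨ concatMap-map proj₂ (attachedCycle N′) (upTo (nv G)) ⟩
    concatMap (λ v → map (λ j → N′ + v * n′ + j) (upTo n′)) (upTo (nv G))
      ≡⟨ concatMap-cong (λ v → map-upTo≡interval (N′ + v * n′) n′) (upTo (nv G)) ⟩
    concatMap (λ v → interval (N′ + v * n′) n′) (upTo (nv G))
      ≡⟨ cong (concatMap (λ v → interval (N′ + v * n′) n′)) (upTo≡interval (nv G)) ⟩
    concatMap (λ v → interval (N′ + v * n′) n′) (interval 0 (nv G))
      ≡⟨ concatMap-intervals N′ n′ 0 (nv G) ⟩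
    interval (N′ + 0) (nv G * n′)
      ≡⟨ cong (λ a → interval a (nv G * n′)) (+-identityʳ N′) ⟩
    interval N′ (nv G * n′) ∎
    where
    open ≡-Reasoning
    N′ : ℕ
    N′ = nv (edgePath m G)

  isCactus-step : ∀ {G r} → IsCactusOf G r → IsCactusOf (step m n G) (stepCactus G r)
  isCactus-step {G} {r} isCactus = record
    { anchored  = anchored-graft (newCycles G) (subdivide N r) anchors (anchored-subdivide N r anchored)
    ; vertices↭ = vertices↭′
    ; edges≡    = edges≡′
    }
    where
    open IsCactusOf isCactus
    N E : ℕ
    N = nv G
    E = length (edges G)
    anchors : All ((_∈ vertices (subdivide N r)) ∘ proj₁) (newCycles G)
    anchors = All.map⁺ (All.tabulate λ v∈ →
      ∈-resp-↭ (↭-sym (vertices-subdivide N r)) (∈-++⁺ˡ (∈-resp-↭ (↭-sym vertices↭) v∈)))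
    vertices↭′ : vertices (stepCactus G r) ↭ upTo (nv (step m n G))
    vertices↭′ = begin
      vertices (graft (newCycles G) (subdivide N r))
        ≡⟨ vertices-graft (newCycles G) (subdivide N r) ⟩
      vertices (subdivide N r) ++ concatMap proj₂ (newCycles G)
        ↭⟨ ++⁺ʳ _ (vertices-subdivide N r) ⟩
      (vertices r ++ interval N (length (cactusEdges r) * m′)) ++ concatMap proj₂ (newCycles G)
        ↭⟨ ++⁺ʳ _ (++⁺ʳ _ vertices↭) ⟩
      (upTo N ++ interval N (length (cactusEdges r) * m′)) ++ concatMap proj₂ (newCycles G)
        ≡⟨ cong₂ (λ k V → (upTo N ++ interval N (k * m′)) ++ V) (cong length edges≡) (vertices-newCycles G) ⟩
      (upTo N ++ interval N (E * m′)) ++ interval (N + E * m′) (N * n′)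
        ≡⟨ cong (λ U → (U ++ interval N (E * m′)) ++ interval (N + E * m′) (N * n′)) (upTo≡interval N) ⟩
      (interval 0 N ++ interval N (E * m′)) ++ interval (N + E * m′) (N * n′)
        ≡⟨ cong (_++ interval (N + E * m′) (N * n′)) (interval-++ 0 N (E * m′)) ⟩
      interval 0 (N + E * m′) ++ interval (N + E * m′) (N * n′)
        ≡⟨ interval-++ 0 (N + E * m′) (N * n′) ⟩
      interval 0 (N + E * m′ + N * n′)
        ≡⟨ sym (upTo≡interval _) ⟩
      upTo (N + E * m′ + N * n′) ∎
      where open PermutationReasoning
    edges≡′ : cactusEdges (stepCactus G r) ≡ edges (step m n G)
    edges≡′ = begin
      cactusEdges (graft (newCycles G) (subdivide N r))
        ≡⟨ cactusEdges-graft (newCycles G) (subdivide N r) ⟩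
      cactusEdges (subdivide N r) ++ concatMap cycleEdges (newCycles G)
        ≡⟨ cong₂ _++_ (sym (subdivEdges-cactusEdges N r))
                      (concatMap-map cycleEdges (attachedCycle (N + E * m′)) (upTo N)) ⟩
      subdivEdges m N 0 (cactusEdges r) ++ concatMap (cycleEdges ∘ attachedCycle (N + E * m′)) (upTo N)
        ≡⟨ cong (λ S → subdivEdges m N 0 S ++ _) edges≡ ⟩
      edges (step m n G) ∎
      where open ≡-Reasoning

  cycleLengthProduct-newCycles : ∀ N′ L → cycleLengthProduct (map (attachedCycle N′) L) ≡ n ^ length L
  cycleLengthProduct-newCycles N′ []      = refl
  cycleLengthProduct-newCycles N′ (v ∷ L) =
    cong₂ _*_ (cong suc (trans (length-map _ (upTo n′)) (length-upTo n′))) (cycleLengthProduct-newCycles N′ L)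

  cycleLengthProduct-step : ∀ G r → cycleLengthProduct (stepCactus G r)
                                    ≡ n ^ nv G * (m ^ length r * cycleLengthProduct r)
  cycleLengthProduct-step G r =
    trans (cycleLengthProduct-graft (newCycles G) (subdivide (nv G) r))
          (cong₂ _*_ (trans (cycleLengthProduct-newCycles _ (upTo (nv G))) (cong (n ^_) (length-upTo (nv G))))
                     (cycleLengthProduct-subdivide (nv G) r))

  length-step : ∀ G r → length (stepCactus G r) ≡ nv G + length r
  length-step G r =
    trans (length-graft (newCycles G) (subdivide (nv G) r))
          (cong₂ _+_ (trans (length-map _ (upTo (nv G))) (length-upTo (nv G))) (length-subdivide (nv G) r))

  cactus : ℕ → Cactus
  cactus zero    = (0 , interval 1 n′) ∷ []
  cactus (suc i) = stepCactus (cycleSelfSimilar i m n) (cactus i)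

  isCactus : ∀ i → IsCactusOf (cycleSelfSimilar i m n) (cactus i)
  isCactus zero    = record
    { anchored  = here refl , _
    ; vertices↭ = ↭-reflexive (sym (upTo≡interval n))
    ; edges≡    = cong (pathEdges 0 0) (sym (map-upTo≡interval 1 n′))
    }
  isCactus (suc i) = isCactus-step (isCactus i)

  length-cactus : ∀ i → length (cactus i) ≡ Σ≤ i (V m n)
  length-cactus zero    = refl
  length-cactus (suc i) = begin
    length (cactus (suc i))                     ≡⟨ length-step (cycleSelfSimilar i m n) (cactus i) ⟩
    V m n (suc i) + length (cactus i)           ≡⟨ cong (V m n (suc i) +_) (length-cactus i) ⟩
    V m n (suc i) + Σ≤ i (V m n)                ≡⟨ +-comm (V m n (suc i)) _ ⟩
    Σ≤ i (V m n) + V m n (suc i)                ≡⟨ sym (Σ≤-suc i (V m n)) ⟩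
    Σ≤ (suc i) (V m n)                          ∎
    where open ≡-Reasoning

  cycleLengthProduct-cactus : ∀ i → cycleLengthProduct (cactus i)
                                    ≡ n ^ Σ≤ i (V m n) * m ^ Σ≤ i (λ j → (i ∸ j) * V m n j)
  cycleLengthProduct-cactus zero    =
    trans (cong (λ k → suc k * 1) (length-interval 1 n′)) (sym (*-identityʳ (n * 1)))
  cycleLengthProduct-cactus (suc i) = begin
    cycleLengthProduct (cactus (suc i))
      ≡⟨ cycleLengthProduct-step (cycleSelfSimilar i m n) (cactus i) ⟩
    n ^ N * (m ^ length (cactus i) * cycleLengthProduct (cactus i))
      ≡⟨ cong₂ (λ a c → n ^ N * (m ^ a * c)) (length-cactus i) (cycleLengthProduct-cactus i) ⟩
    n ^ N * (m ^ p * (n ^ p * m ^ q))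
      ≡⟨ solve 4 (λ nN mp np mq → nN :* (mp :* (np :* mq)) := np :* nN :* (mq :* mp)) refl
                 (n ^ N) (m ^ p) (n ^ p) (m ^ q) ⟩
    n ^ p * n ^ N * (m ^ q * m ^ p)
      ≡⟨ sym (cong₂ _*_ (^-distribˡ-+-* n p N) (^-distribˡ-+-* m q p)) ⟩
    n ^ (p + N) * m ^ (q + p)
      ≡⟨ sym (cong₂ (λ a b → n ^ a * m ^ b) (Σ≤-suc i (V m n)) (Σ≤-weighted-suc i (V m n))) ⟩
    n ^ Σ≤ (suc i) (V m n) * m ^ Σ≤ (suc i) (λ j → (suc i ∸ j) * V m n j) ∎
    where
    open ≡-Reasoning
    N p q : ℕ
    N = V m n (suc i)
    p = Σ≤ i (V m n)
    q = Σ≤ i (λ j → (i ∸ j) * V m n j)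

-- The proof only needs n, m ≥ 1.
theorem1 : (n m : ℕ) → 3 ≤ n → 2 ≤ m → (i : ℕ) →
    τ (cycleSelfSimilar i m n)
      ≡ n ^ Σ≤ i (λ j → V m n j) * m ^ Σ≤ i (λ j → (i ∸ j) * V m n j)
theorem1 (suc n′) (suc m′) _ _ i = trans (τ-cactus (isCactus i)) (cycleLengthProduct-cactus i)
  where open Construction m′ n′
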